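{- Let $G=(V,E)$ be a finite graph (directed or undirected) with strictly positive edge weights, and let $s_1,\dots,s_S\in V$ be $S$ source nodes. For each $j\in\{1,\dots,S\}$ let $d_j(v)$ denote the shortest-path distance from $s_j$ to $v$ in $G$. Run $S$ instances of Dijkstra's Algorithm, the $j$-th one from source $s_j$, each with its own priority queue, the instances being executed in some interleaved (e.g. alternating) order. Call a node an intersection node once it has been extracted (visited) by all $S$ instances, and for an intersection node $w$ let $d_{\max}=\max_{1\le j\le S} d_j(w)$ denote its maximum distance to the sources. Suppose that for some $k\in\{1,\dots,S\}$ the $k$-th instance extracts from its priority queue a node $u$ whose distance $d_k(u)$ exceeds $d_{\max}$. Then every node $v$ that is extracted by the $k$-th instance at or after the extraction of $u$ (i.e. all remaining nodes to be explored by that instance) satisfies $\max_{1\le j\le S} d_j(v)\ge d_{\max}$; that is, none of these nodes yields a smaller maximum distance to the sources than $d_{\max}$.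
   Context: Dijkstra's Algorithm from a source $s$: all distances are initialized to $\infty$ except $s$ (distance $0$); repeatedly the unvisited node with the smallest tentative distance is extracted from the priority queue, marked visited (never revisited), and the tentative distances of its neighbors are relaxed (updated to the smaller of the current value and the extracted node's distance plus the edge weight). The distance with which a node is extracted equals its shortest-path distance from $s$.
   Formalization: The edge weights are strictly positive rationals, and the distances $d_j(v)$ are taken in the rationals extended by ∞. -}

module Defs where

open import Data.Nat using (ℕ; zero; suc)
open import Data.Fin using (Fin; zero; suc; _≟_)
open import Data.Bool using (Bool; true; false; if_then_else_)
open import Data.Maybe using (Maybe; just; nothing)
open import Data.Product using (_×_; _,_)
open import Data.List using (List; []; _∷_)
open import Data.Rational using (ℚ; 0ℚ; _+_; _≤_; _<_; _⊓_; _⊔_)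
open import Relation.Binary.PropositionalEquality using (_≡_)
open import Relation.Nullary using (¬_; yes; no)

data ℚ∞ : Set where
  fin : ℚ → ℚ∞
  ∞   : ℚ∞

data _≤∞_ : ℚ∞ → ℚ∞ → Set where
  fin≤fin : ∀ {p q} → p ≤ q → fin p ≤∞ fin q
  _≤∞∞    : ∀ x → x ≤∞ ∞

data _<∞_ : ℚ∞ → ℚ∞ → Set where
  fin<fin : ∀ {p q} → p < q → fin p <∞ fin q
  fin<∞   : ∀ p → fin p <∞ ∞

_+∞_ : ℚ∞ → ℚ∞ → ℚ∞
fin p +∞ fin q = fin (p + q)
_     +∞ _     = ∞

_⊓∞_ : ℚ∞ → ℚ∞ → ℚ∞
fin p ⊓∞ fin q = fin (p ⊓ q)
fin p ⊓∞ ∞     = fin p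
∞     ⊓∞ y     = y

_⊔∞_ : ℚ∞ → ℚ∞ → ℚ∞
fin p ⊔∞ fin q = fin (p ⊔ q)
_     ⊔∞ _     = ∞

maxOver : ∀ {m} → (Fin (suc m) → ℚ∞) → ℚ∞
maxOver {zero}  f = f zero
maxOver {suc m} f = f zero ⊔∞ maxOver {m} (λ i → f (suc i))

-- Weighted (directed) graphs on the vertex set Fin n.
-- W u v = just q : there is an edge u → v of weight q;  nothing : no edge.
-- An undirected graph is the special case of a symmetric W.

Graph : ℕ → Set
Graph n = Fin n → Fin n → Maybe ℚ

PositiveWeights : ∀ {n} → Graph n → Set
PositiveWeights {n} W = ∀ (u v : Fin n) (q : ℚ) → W u v ≡ just q → 0ℚ < q

data Walk {n} (W : Graph n) : Fin n → Fin n → ℚ → Set where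
  [] : ∀ {u} → Walk W u u 0ℚ
  _∷_ : ∀ {u v t q r} → W u v ≡ just q → Walk W v t r → Walk W u t (q + r)

IsShortestDist : ∀ {n} → Graph n → Fin n → Fin n → ℚ∞ → Set
IsShortestDist W s v (fin q) = Walk W s v q × (∀ r → Walk W s v r → q ≤ r)
IsShortestDist W s v ∞       = ∀ r → ¬ Walk W s v r

record DState (n : ℕ) : Set where
  constructor dstate
  field
    visited   : Fin n → Bool
    tentative : Fin n → ℚ∞
open DState public

initState : ∀ {n} → Fin n → DState n
initState s = dstate (λ _ → false) (λ v → if ⌊ v ≟ s ⌋′ then fin 0ℚ else ∞)
  where
  ⌊_⌋′ : ∀ {A : Set} {a b : A} → Relation.Nullary.Dec (a ≡ b) → Bool
  ⌊ yes _ ⌋′ = true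
  ⌊ no  _ ⌋′ = false

relax : ℚ∞ → ℚ∞ → Maybe ℚ → ℚ∞
relax dv du (just q) = dv ⊓∞ (du +∞ fin q)
relax dv du nothing  = dv

CanExtract : ∀ {n} → DState n → Fin n → Set
CanExtract {n} st u =
  visited st u ≡ false × (∀ (v : Fin n) → visited st v ≡ false → tentative st u ≤∞ tentative st v)

extract : ∀ {n} → Graph n → DState n → Fin n → DState n
extract W st u = dstate
  (λ v → if isYes (v ≟ u) then true else visited st v)
  (λ v → relax (tentative st v) (tentative st u) (W u v))
  where
  isYes : ∀ {A : Set} {a b : A} → Relation.Nullary.Dec (a ≡ b) → Bool
  isYes (yes _) = true
  isYes (no  _) = false

-- S' + 1 interleaved instances (instance j runs from source src j).

GState : ℕ → ℕ → Set
GState S' n = Fin (suc S') → DState n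

initG : ∀ {S' n} → (Fin (suc S') → Fin n) → GState S' n
initG src j = initState (src j)

stepG : ∀ {S' n} → Graph n → GState S' n → Fin (suc S') → Fin n → GState S' n
stepG W g k u j with j ≟ k
... | yes _ = extract W (g j) u
... | no  _ = g j

Event : ℕ → ℕ → Set
Event S' n = Fin (suc S') × Fin n

data Run {S' n} (W : Graph n) : GState S' n → List (Event S' n) → GState S' n → Set where
  done : ∀ {g} → Run W g [] g
  step : ∀ {g k u es g'} → CanExtract (g k) u →
         Run W (stepG W g k u) es g' → Run W g ((k , u) ∷ es) g'

IntersectionNode : ∀ {S' n} → GState S' n → Fin n → Set
IntersectionNode g w = ∀ j → visited (g j) w ≡ true

-- Within one instance of Dijkstra's algorithm the extracted tentative
-- distances never decrease: after extracting u every unvisited node has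
-- tentative distance at least that of u, and relaxing along nonnegative edges
-- preserves this.  The usual invariant (finite tentative values are realised by
-- walks, edges out of visited nodes are relaxed, visited nodes lie below
-- unvisited ones) shows that a node is extracted with its true distance.  So
-- any v that instance k extracts at or after u has
-- max_j d_j(v) ≥ d_k(v) ≥ d_k(u) > d_max.

module Submission where

open import Defs
open import Data.Nat using (ℕ; suc; zero)
open import Data.Fin using (Fin; _≟_)
open import Data.Product using (Σ-syntax; _×_; _,_; proj₁; proj₂)
open import Data.Sum using (_⊎_; inj₁; inj₂)
open import Data.List using (List; _∷_)
open import Data.List.Membership.Propositional using (_∈_)
open import Data.List.Relation.Unary.Any using (here; there)
open import Data.Bool using (true; false)
open import Data.Maybe using (just; nothing)
open import Data.Empty using (⊥-elim)
open import Relation.Nullary using (yes; no; ¬_)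
open import Relation.Binary.PropositionalEquality using (_≡_; refl; sym; trans; cong; subst)
open import Data.Rational using (ℚ; 0ℚ; _+_; _≤_)
import Data.Rational.Properties as ℚ

p≤p+q : ∀ p {q} → 0ℚ ≤ q → p ≤ p + q
p≤p+q p {q} 0≤q = ℚ.≤-trans (ℚ.≤-reflexive (sym (ℚ.+-identityʳ p))) (ℚ.+-monoʳ-≤ p 0≤q)

≤∞-refl : ∀ x → x ≤∞ x
≤∞-refl (fin p) = fin≤fin ℚ.≤-refl
≤∞-refl ∞       = ∞ ≤∞∞

≤∞-reflexive : ∀ {p q} → p ≡ q → fin p ≤∞ fin q
≤∞-reflexive p≡q = fin≤fin (ℚ.≤-reflexive p≡q)

≤∞-trans : ∀ {x y z} → x ≤∞ y → y ≤∞ z → x ≤∞ z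
≤∞-trans _             (_ ≤∞∞)       = _ ≤∞∞
≤∞-trans (fin≤fin p≤q) (fin≤fin q≤r) = fin≤fin (ℚ.≤-trans p≤q q≤r)

<∞⇒≤∞ : ∀ {x y} → x <∞ y → x ≤∞ y
<∞⇒≤∞ (fin<fin p<q) = fin≤fin (ℚ.<⇒≤ p<q)
<∞⇒≤∞ (fin<∞ p)     = fin p ≤∞∞

⊓∞-glb : ∀ {a} x y → a ≤∞ x → a ≤∞ y → a ≤∞ (x ⊓∞ y)
⊓∞-glb (fin p) (fin q) (fin≤fin a≤p) (fin≤fin a≤q) = fin≤fin (ℚ.⊓-glb a≤p a≤q)
⊓∞-glb (fin p) ∞       a≤x _   = a≤x
⊓∞-glb ∞       y       _   a≤y = a≤y

x⊓∞y≤∞x : ∀ x y → (x ⊓∞ y) ≤∞ x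
x⊓∞y≤∞x (fin p) (fin q) = fin≤fin (ℚ.p⊓q≤p p q)
x⊓∞y≤∞x (fin p) ∞       = ≤∞-refl (fin p)
x⊓∞y≤∞x ∞       y       = _ ≤∞∞

x⊓∞y≤∞y : ∀ x y → (x ⊓∞ y) ≤∞ y
x⊓∞y≤∞y (fin p) (fin q) = fin≤fin (ℚ.p⊓q≤q p q)
x⊓∞y≤∞y (fin p) ∞       = _ ≤∞∞
x⊓∞y≤∞y ∞       y       = ≤∞-refl y

x≤∞x⊔∞y : ∀ x y → x ≤∞ (x ⊔∞ y)
x≤∞x⊔∞y (fin p) (fin q) = fin≤fin (ℚ.p≤p⊔q p q)
x≤∞x⊔∞y (fin p) ∞       = _ ≤∞∞
x≤∞x⊔∞y ∞       y       = _ ≤∞∞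

y≤∞x⊔∞y : ∀ x y → y ≤∞ (x ⊔∞ y)
y≤∞x⊔∞y (fin p) (fin q) = fin≤fin (ℚ.p≤q⊔p p q)
y≤∞x⊔∞y (fin p) ∞       = _ ≤∞∞
y≤∞x⊔∞y ∞       y       = _ ≤∞∞

x≤∞x+∞q : ∀ {q} → 0ℚ ≤ q → ∀ x → x ≤∞ (x +∞ fin q)
x≤∞x+∞q 0≤q (fin p) = fin≤fin (p≤p+q p 0≤q)
x≤∞x+∞q 0≤q ∞       = ∞ ≤∞∞

+∞-monoˡ-≤∞ : ∀ q {x y} → x ≤∞ y → (x +∞ fin q) ≤∞ (y +∞ fin q)
+∞-monoˡ-≤∞ q (fin≤fin p≤r) = fin≤fin (ℚ.+-monoˡ-≤ q p≤r)
+∞-monoˡ-≤∞ q (x ≤∞∞)       = _ ≤∞∞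

≤∞-maxOver : ∀ {m} (f : Fin (suc m) → ℚ∞) i → f i ≤∞ maxOver f
≤∞-maxOver {zero}  f Fin.zero    = ≤∞-refl (f Fin.zero)
≤∞-maxOver {suc m} f Fin.zero    = x≤∞x⊔∞y (f Fin.zero) _
≤∞-maxOver {suc m} f (Fin.suc i) =
  ≤∞-trans (≤∞-maxOver (λ j → f (Fin.suc j)) i) (y≤∞x⊔∞y (f Fin.zero) _)

relax-≤∞ : ∀ dv du mq → relax dv du mq ≤∞ dv
relax-≤∞ dv du (just q) = x⊓∞y≤∞x dv (du +∞ fin q)
relax-≤∞ dv du nothing  = ≤∞-refl dv

relax-≤∞-edge : ∀ dv du {mq q} → mq ≡ just q → relax dv du mq ≤∞ (du +∞ fin q)
relax-≤∞-edge dv du refl = x⊓∞y≤∞y dv _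

relax-glb : ∀ {a} dv du mq → a ≤∞ dv → (∀ q → mq ≡ just q → a ≤∞ (du +∞ fin q)) →
            a ≤∞ relax dv du mq
relax-glb dv du (just q) a≤dv a≤du+q = ⊓∞-glb dv (du +∞ fin q) a≤dv (a≤du+q q refl)
relax-glb dv du nothing  a≤dv _      = a≤dv

fin-injective : ∀ {p q} → fin p ≡ fin q → p ≡ q
fin-injective refl = refl

relax-fin : ∀ dv du mq {r} → relax dv du mq ≡ fin r →
            dv ≡ fin r ⊎ Σ[ p ∈ ℚ ] Σ[ q ∈ ℚ ] (du ≡ fin p × mq ≡ just q × r ≡ p + q)
relax-fin dv      du      nothing  eq = inj₁ eq
relax-fin (fin a) (fin b) (just q) eq with ℚ.⊓-sel a (b + q)
... | inj₁ e = inj₁ (trans (cong fin (sym e)) eq)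
... | inj₂ e = inj₂ (b , q , refl , refl , sym (fin-injective (trans (cong fin (sym e)) eq)))
relax-fin (fin a) ∞       (just q) eq = inj₁ eq
relax-fin ∞       (fin b) (just q) eq = inj₂ (b , q , refl , refl , sym (fin-injective eq))
relax-fin ∞       ∞       (just q) ()

visited-extract-self : ∀ {n} W (st : DState n) u → visited (extract W st u) u ≡ true
visited-extract-self W st u with u ≟ u
... | yes _  = refl
... | no u≢u = ⊥-elim (u≢u refl)

visited-extract-other : ∀ {n} W (st : DState n) {u v} → ¬ v ≡ u →
                        visited (extract W st u) v ≡ visited st v
visited-extract-other W st {u} {v} v≢u with v ≟ u
... | yes v≡u = ⊥-elim (v≢u v≡u)
... | no _    = refl

unvisited-extract : ∀ {n} W (st : DState n) {u v} → visited (extract W st u) v ≡ false →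
                    visited st v ≡ false
unvisited-extract W st {u} {v} unv with v ≟ u
unvisited-extract W st ()  | yes _
... | no _ = unv

stepG-self : ∀ {S' n} W (g : GState S' n) k u → stepG W g k u k ≡ extract W (g k) u
stepG-self W g k u with k ≟ k
... | yes _  = refl
... | no k≢k = ⊥-elim (k≢k refl)

stepG-preserves : ∀ {S' n} {W} {g : GState S' n} {k u}
                  (P : Fin (suc S') → DState n → Set) →
                  (P k (g k) → P k (extract W (g k) u)) →
                  ∀ j → P j (g j) → P j (stepG W g k u j)
stepG-preserves {k = k} P extract-preserves j Pj with j ≟ k
... | yes refl = extract-preserves Pj
... | no _     = Pj

UnvisitedAtLeast : ∀ {n} → ℚ∞ → DState n → Set
UnvisitedAtLeast m st = ∀ y → visited st y ≡ false → m ≤∞ tentative st y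

module _ {n} {W : Graph n} (pos : PositiveWeights W) where

  weight-nonneg : ∀ {u v q} → W u v ≡ just q → 0ℚ ≤ q
  weight-nonneg {u} {v} {q} e = ℚ.<⇒≤ (pos u v q e)

  walk-nonneg : ∀ {a b r} → Walk W a b r → 0ℚ ≤ r
  walk-nonneg []      = ℚ.≤-refl
  walk-nonneg (e ∷ p) =
    ℚ.≤-trans (ℚ.≤-reflexive (sym (ℚ.+-identityʳ 0ℚ))) (ℚ.+-mono-≤ (weight-nonneg e) (walk-nonneg p))

  walk-snoc : ∀ {a u v r q} → Walk W a u r → W u v ≡ just q → Walk W a v (r + q)
  walk-snoc {a} {v = v} {q = q} [] e =
    subst (Walk W a v) (trans (ℚ.+-identityʳ q) (sym (ℚ.+-identityˡ q))) (e ∷ [])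
  walk-snoc {a} {v = v} {q = q} (_∷_ {q = q′} {r = r} e′ p) e =
    subst (Walk W a v) (sym (ℚ.+-assoc q′ r q)) (e′ ∷ walk-snoc p e)

  extract-preserves-UnvisitedAtLeast : ∀ {m st u} → UnvisitedAtLeast m st → CanExtract st u →
                                       UnvisitedAtLeast m (extract W st u)
  extract-preserves-UnvisitedAtLeast {st = st} {u} m≤ (u-unv , _) y unv =
    relax-glb (tentative st y) (tentative st u) (W u y) (m≤ y (unvisited-extract W st unv))
      (λ q e → ≤∞-trans (m≤ u u-unv) (x≤∞x+∞q (weight-nonneg e) (tentative st u)))

  -- CanExtract st u says in particular UnvisitedAtLeast (tentative st u) st.
  extract-UnvisitedAtLeast : ∀ {st u} → CanExtract st u →
                             UnvisitedAtLeast (tentative st u) (extract W st u)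
  extract-UnvisitedAtLeast can = extract-preserves-UnvisitedAtLeast (proj₂ can) can

  record DijkstraInvariant (s : Fin n) (st : DState n) : Set where
    field
      tentative-walk    : ∀ v q → tentative st v ≡ fin q → Walk W s v q
      source-tentative  : tentative st s ≤∞ fin 0ℚ
      visited-relaxed   : ∀ x y q → visited st x ≡ true → W x y ≡ just q →
                          tentative st y ≤∞ (tentative st x +∞ fin q)
      visited≤unvisited : ∀ x y → visited st x ≡ true → visited st y ≡ false →
                          tentative st x ≤∞ tentative st y
  open DijkstraInvariant

  initState-invariant : ∀ s → DijkstraInvariant s (initState s)
  initState-invariant s = record
    { tentative-walk    = walk
    ; source-tentative  = source
    ; visited-relaxed   = λ _ _ _ ()
    ; visited≤unvisited = λ _ _ ()
    }
    where
    walk : ∀ v q → tentative (initState s) v ≡ fin q → Walk W s v q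
    walk v q eq with v ≟ s
    walk v q refl | yes refl = []
    walk v q ()   | no _
    source : tentative (initState s) s ≤∞ fin 0ℚ
    source with s ≟ s
    ... | yes _  = ≤∞-refl (fin 0ℚ)
    ... | no s≢s = ⊥-elim (s≢s refl)

  extract-preserves-invariant : ∀ {s st u} → DijkstraInvariant s st → CanExtract st u →
                                DijkstraInvariant s (extract W st u)
  extract-preserves-invariant {s} {st} {u} inv can = record
    { tentative-walk    = walk
    ; source-tentative  = ≤∞-trans (relax-≤∞ _ _ (W u s)) (source-tentative inv)
    ; visited-relaxed   = relaxed
    ; visited≤unvisited = ordered
    }
    where
    st′ = extract W st u

    walk : ∀ v q → tentative st′ v ≡ fin q → Walk W s v q
    walk v q eq with relax-fin (tentative st v) (tentative st u) (W u v) eq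
    ... | inj₁ e                        = tentative-walk inv v q e
    ... | inj₂ (p , _ , eu , ev , refl) = walk-snoc (tentative-walk inv u p eu) ev

    below-u : ∀ x → visited st′ x ≡ true → tentative st x ≤∞ tentative st u
    below-u x vis with x ≟ u
    ... | yes refl = ≤∞-refl _
    ... | no _     = visited≤unvisited inv x u vis (proj₁ can)

    visited-unchanged : ∀ x → visited st′ x ≡ true → tentative st x ≤∞ tentative st′ x
    visited-unchanged x vis = relax-glb (tentative st x) (tentative st u) (W u x) (≤∞-refl _)
      (λ q e → ≤∞-trans (below-u x vis) (x≤∞x+∞q (weight-nonneg e) (tentative st u)))

    relaxed : ∀ x y q → visited st′ x ≡ true → W x y ≡ just q →
              tentative st′ y ≤∞ (tentative st′ x +∞ fin q)
    relaxed x y q vis e with x ≟ u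
    ... | yes refl = ≤∞-trans (relax-≤∞-edge (tentative st y) (tentative st x) e)
                       (+∞-monoˡ-≤∞ q (visited-unchanged x (visited-extract-self W st x)))
    ... | no x≢u   = ≤∞-trans (relax-≤∞ _ _ (W u y))
                       (≤∞-trans (visited-relaxed inv x y q vis e)
                          (+∞-monoˡ-≤∞ q (visited-unchanged x (trans (visited-extract-other W st x≢u) vis))))

    ordered : ∀ x y → visited st′ x ≡ true → visited st′ y ≡ false →
              tentative st′ x ≤∞ tentative st′ y
    ordered x y vis unv = ≤∞-trans (relax-≤∞ _ _ (W u x))
      (≤∞-trans (below-u x vis) (extract-UnvisitedAtLeast can y unv))

  -- The first unvisited node of the walk does the job: all edges before it
  -- leave visited nodes and are therefore relaxed.
  walk-reaches-unvisited : ∀ {s st a u r c} → DijkstraInvariant s st → Walk W a u r →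
                           visited st u ≡ false → tentative st a ≤∞ fin c →
                           Σ[ y ∈ Fin n ] (visited st y ≡ false × tentative st y ≤∞ fin (c + r))
  walk-reaches-unvisited {u = u} {c = c} inv [] unv a≤c =
    u , unv , ≤∞-trans a≤c (≤∞-reflexive (sym (ℚ.+-identityʳ c)))
  walk-reaches-unvisited {st = st} {a = a} {c = c} inv (_∷_ {v = b} {q = q} {r = r} e p) unv a≤c
    with visited st a in a-vis
  ... | false = a , a-vis , ≤∞-trans a≤c (fin≤fin (p≤p+q c (walk-nonneg (e ∷ p))))
  ... | true with walk-reaches-unvisited inv p unv
                    (≤∞-trans (visited-relaxed inv a b q a-vis e) (+∞-monoˡ-≤∞ q a≤c))
  ... | y , y-unv , y≤ = y , y-unv , ≤∞-trans y≤ (≤∞-reflexive (ℚ.+-assoc c q r))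

  shortest≤∞tentative : ∀ {s st v D} → DijkstraInvariant s st → IsShortestDist W s v D →
                        D ≤∞ tentative st v
  shortest≤∞tentative {st = st} {v} {fin q} inv (_ , minimal) with tentative st v in eq
  ... | fin t = fin≤fin (minimal t (tentative-walk inv v t eq))
  ... | ∞     = _ ≤∞∞
  shortest≤∞tentative {st = st} {v} {∞} inv unreachable with tentative st v in eq
  ... | fin t = ⊥-elim (unreachable t (tentative-walk inv v t eq))
  ... | ∞     = ∞ ≤∞∞

  extracted-tentative≤∞shortest : ∀ {s st u D} → DijkstraInvariant s st →
                                  IsShortestDist W s u D → CanExtract st u →
                                  tentative st u ≤∞ D
  extracted-tentative≤∞shortest {D = fin q} inv (walk , _) (u-unv , u-min)
    with walk-reaches-unvisited inv walk u-unv (source-tentative inv)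
  ... | y , y-unv , y≤ = ≤∞-trans (u-min y y-unv) (≤∞-trans y≤ (≤∞-reflexive (ℚ.+-identityˡ q)))
  extracted-tentative≤∞shortest {D = ∞} _ _ _ = _ ≤∞∞

  module _ {S' : ℕ} (src : Fin (suc S') → Fin n) where

    GlobalInvariant : GState S' n → Set
    GlobalInvariant g = ∀ j → DijkstraInvariant (src j) (g j)

    stepG-preserves-invariant : ∀ {g k u} → GlobalInvariant g → CanExtract (g k) u →
                                GlobalInvariant (stepG W g k u)
    stepG-preserves-invariant inv can j =
      stepG-preserves (λ j → DijkstraInvariant (src j))
        (λ inv-k → extract-preserves-invariant inv-k can) j (inv j)

    run-preserves-invariant : ∀ {g es g′} → Run W g es g′ → GlobalInvariant g → GlobalInvariant g′
    run-preserves-invariant done         inv = inv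
    run-preserves-invariant (step can r) inv = run-preserves-invariant r (stepG-preserves-invariant inv can)

    module _ (d : Fin (suc S') → Fin n → ℚ∞)
             (shortest : ∀ j v → IsShortestDist W (src j) v (d j v)) where

      later-extractions-≥ : ∀ {m g es g′ k v} → Run W g es g′ → GlobalInvariant g →
                            UnvisitedAtLeast m (g k) → (k , v) ∈ es → m ≤∞ d k v
      later-extractions-≥ {k = k} (step can _) inv m≤ (here refl) =
        ≤∞-trans (m≤ _ (proj₁ can)) (extracted-tentative≤∞shortest (inv k) (shortest k _) can)
      later-extractions-≥ {m} {k = k} (step can r) inv m≤ (there mem) =
        later-extractions-≥ r (stepG-preserves-invariant inv can)
          (stepG-preserves (λ _ → UnvisitedAtLeast m)
            (λ m≤k → extract-preserves-UnvisitedAtLeast m≤k can) k m≤)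
          mem

      extracted-distances-monotone : ∀ {g es g′ k u v} → GlobalInvariant g →
                                     Run W g ((k , u) ∷ es) g′ → (k , v) ∈ ((k , u) ∷ es) →
                                     d k u ≤∞ d k v
      extracted-distances-monotone _ _ (here refl) = ≤∞-refl _
      extracted-distances-monotone {g} {k = k} {u} inv (step can r) (there mem) =
        ≤∞-trans (shortest≤∞tentative (inv k) (shortest k u))
          (later-extractions-≥ r (stepG-preserves-invariant inv can)
            (subst (UnvisitedAtLeast (tentative (g k) u)) (sym (stepG-self W g k u))
              (extract-UnvisitedAtLeast can))
            mem)

mainTheorem1 : ∀ {n S' : ℕ} (W : Graph n) → PositiveWeights W →
    (src : Fin (suc S') → Fin n) →
    (d : Fin (suc S') → Fin n → ℚ∞) →
    (∀ j v → IsShortestDist W (src j) v (d j v)) →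
    (g₁ g₂ : GState S' n) (es₁ es₂ : List (Event S' n)) (k : Fin (suc S')) (u w : Fin n) →
    Run W (initG src) es₁ g₁ →
    Run W g₁ ((k , u) ∷ es₂) g₂ →
    IntersectionNode g₁ w →
    maxOver (λ j → d j w) <∞ d k u →
    ∀ (v : Fin n) → (k , v) ∈ ((k , u) ∷ es₂) →
    maxOver (λ j → d j w) ≤∞ maxOver (λ j → d j v)
mainTheorem1 W pos src d shortest g₁ g₂ es₁ es₂ k u w run₁ run₂ _ dmax<dku v v-later =
  ≤∞-trans (<∞⇒≤∞ dmax<dku)
    (≤∞-trans (extracted-distances-monotone pos src d shortest invariant₁ run₂ v-later)
      (≤∞-maxOver (λ j → d j v) k))
  where
  invariant₁ : GlobalInvariant pos src g₁
  invariant₁ = run-preserves-invariant pos src run₁ (λ j → initState-invariant pos (src j))
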